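{- Let $\langle\rho,P\rangle$ be a configuration with $(\Sigma_\rho,\Sigma_P)\vdash\langle\rho,P\rangle$, let $s$ be a scheduler, and suppose $\langle\rho,P\rangle\xrightarrow{\tau}_{s}\Delta$. Then $(\Sigma_\rho,\Sigma_P)\vdash\Delta$.
   Context: Notation. For a set $S$, $\mathcal D(S)$ is the set of finitely supported probability distributions on $S$; $\overline{s}$ is the point distribution at $s$; $\sum_{i}p_i\bullet\Delta_i$ is a convex combination of distributions ($p_i\ge 0$, $\sum_i p_i=1$). Qubit names range over a denumerable set $\mathcal Q$; for a finite $\Sigma\subseteq\mathcal Q$, $\mathcal H_\Sigma=(\mathbb C^2)^{\otimes|\Sigma|}$. A superoperator with Kraus operators $\{E_i\}$ maps $\rho\mapsto\sum_iE_i\rho E_i^\dagger$; it is trace-preserving if $\sum_iE_i^\dagger E_i=\mathbb I$. A measurement is $\mathbb M=\{M_m\}_{m=0}^{k-1}$ with $\sum_mM_m^\dagger M_m=\mathbb I$, and $\mathcal M_m(\sigma)=M_m\sigma M_m^\dagger$. For a superoperator $\mathcal E$ on $n$ qubits and a tuple $\tilde q$ of $n$ distinct qubit names of $\rho$, $\mathcal E^{\tilde q}$ applies $\mathcal E$ to the qubits $\tilde q$ and the identity to the remaining ones. Syntax (tagged lqCCS). Tags $t$ range over a denumerable set $\mathit{Tag}$; each channel $c$ has a type $\widehat{\mathbb N}$, $\widehat{\mathbb B}$ or $\widehat{\mathcal Q}$. Processes: $P::=t:\tau.P\mid (t,t'):\tau.P\mid t:\mathcal E(\tilde e).P\mid t:\mathbb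 M(\tilde e\rhd x).P\mid t:c?x.P\mid \mathbf 0_{\tilde e}\mid t:c!e.P\mid \mathrm{if}\ e\ \mathrm{then}\ P\ \mathrm{else}\ P\mid P+P\mid P\parallel P\mid P\setminus c$, with expressions $e::=x\mid b\mid n\mid q\mid\neg e\mid e\lor e\mid e\le e\mid e=e$ ($b$ Boolean, $n\in\mathbb N$, $q\in\mathcal Q$), $\mathcal E$ a trace-preserving superoperator of arity $n$ and $\mathbb M$ a measurement on $n$ qubits. Closed expressions evaluate, $e\Downarrow v$, to values (naturals, Booleans, qubit names); $q=q'$ compares names. Typing. Judgement $\Sigma\vdash P$ ($\Sigma$ a set of qubit names/quantum variables): $\Sigma\vdash\mathbf 0_{\tilde e}$ if $\tilde e$ enumerates $\Sigma$; $\tau$-prefixes and restriction keep the context of the continuation; $\Sigma\vdash P+Q$ and $\Sigma\vdash\mathrm{if}\ e\ \mathrm{then}\ P\ \mathrm{else}\ Q$ ($e$ Boolean) if $\Sigma\vdash P$ and $\Sigma\vdash Q$; $\Sigma\vdash t:\mathcal E(\tilde e).P$ and $\Sigma\vdash t:\mathbb M(\tilde e\rhd y).P$ ($y$ natural) if $\tilde e$ enumerates a set $E\subseteq\Sigma$ of size the arity and $\Sigma\vdash P$; classical receive/send on a channel of type $\widehat T$, $T\in\{\mathbb B,\mathbb N\}$, with variable/expression of type $T$: $\Sigma\vdash P$; $\Sigma\vdash t:c?x.P$ with $c:\widehat{\mathcal Q}$, $x:\mathcal Q$ if $\Sigma\cup\{x\}\vdash P$; $\Sigma\vdash t:c!e.P$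 with $c:\widehat{\mathcal Q}$ if $e\in\Sigma$ and $\Sigma\setminus\{e\}\vdash P$; $\Sigma_1\cup\Sigma_2\vdash P_1\parallel P_2$ if $\Sigma_1\cap\Sigma_2=\emptyset$ and $\Sigma_i\vdash P_i$. Typing is unique; $\Sigma_P$ denotes the context typing $P$. Configurations. $\langle\rho,P\rangle$ with $P$ closed and $\rho$ a density operator on $\mathcal H_{\Sigma_\rho}$; $(\Sigma_\rho,\Sigma_P)\vdash\langle\rho,P\rangle$ if $\Sigma_P\subseteq\Sigma_\rho$; for $\Delta\in\mathcal D(\mathit{Conf})$, $(\Sigma,\Sigma')\vdash\Delta$ if every configuration in its support is so typed. Semantics. Schedulers: $s::=h\mid t\mid (t,t')$. Actions: $\tau$, $c!v$, $c?v$. The transition relation $\langle\rho,P\rangle\xrightarrow{\mu}_s\Delta$ ($\Delta\in\mathcal D(\mathit{Conf})$) is the least relation with: $\langle\rho,t:\tau.P\rangle\xrightarrow{\tau}_t\overline{\langle\rho,P\rangle}$; $\langle\rho,(t,t'):\tau.P\rangle\xrightarrow{\tau}_{(t,t')}\overline{\langle\rho,P\rangle}$; $\langle\rho,t:c!e.P\rangle\xrightarrow{c!v}_t\overline{\langle\rho,P\rangle}$ if $e\Downarrow v$; $\langle\rho,t:c?x.P\rangle\xrightarrow{c?v}_t\overline{\langle\rho,P[v/x]\rangle}$ (with $v\in\Sigma_\rho$ if $c:\widehat{\mathcal Q}$); $\langle\rho,t:\mathcal E(\tilde q).P\rangle\xrightarrow{\tau}_t\overline{\langle\mathcal E^{\tilde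 q}(\rho),P\rangle}$; $\langle\rho,t:\mathbb M(\tilde q\rhd y).P\rangle\xrightarrow{\tau}_t\sum_mp_m\bullet\overline{\langle\mathcal M_m^{\tilde q}(\rho)/p_m,P[m/y]\rangle}$ with $p_m=\mathrm{tr}(\mathcal M^{\tilde q}_m(\rho))$; $\mathrm{if}\ e\ \mathrm{then}\ P\ \mathrm{else}\ Q$ has the transitions of $P$ if $e\Downarrow\mathit{tt}$ and of $Q$ if $e\Downarrow\mathit{ff}$; $P+Q$ has the transitions of $P$ and of $Q$; if $\langle\rho,P\rangle\xrightarrow{\mu}_s\Delta$ with $\mu\notin\{c!v,c?v\}$ then $\langle\rho,P\setminus c\rangle\xrightarrow{\mu}_s\Delta\setminus c$; if $\langle\rho,P\rangle\xrightarrow{\mu}_s\Delta$ and $\mu$ is not of the form $c?v$ with $v\in\Sigma_Q$ then $\langle\rho,P\parallel Q\rangle\xrightarrow{\mu}_s\Delta\parallel Q$ (and symmetrically for the right component); if $\langle\rho,P\rangle\xrightarrow{c!v}_t\overline{\langle\rho,P'\rangle}$ and $\langle\rho,Q\rangle\xrightarrow{c?v}_{t'}\overline{\langle\rho,Q'\rangle}$ then $\langle\rho,P\parallel Q\rangle\xrightarrow{\tau}_{(t,t')}\overline{\langle\rho,P'\parallel Q'\rangle}$ and $\langle\rho,Q\parallel P\rangle\xrightarrow{\tau}_{(t,t')}\overline{\langle\rho,Q'\parallel P'\rangle}$. Here $\Delta\parallel Q$ and $\Delta\setminus c$ are applied pointwise to the support. -}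

module Defs where

open import Data.Nat using (ℕ) renaming (_≡ᵇ_ to _≡ℕ_; _≤ᵇ_ to _≤ℕ_)
open import Data.Bool using (Bool; true; false; not; _∨_; _∧_; if_then_else_)
open import Data.Maybe using (Maybe; just; nothing)
open import Data.List using (List; []; _∷_; map; filter; _++_; concatMap)
open import Data.List.Membership.Propositional using (_∈_; _∉_)
open import Data.List.Relation.Unary.All using (All)
open import Data.List.Relation.Unary.Unique.Propositional using (Unique)
open import Data.Vec using (Vec; toList)
open import Data.Fin using (Fin; toℕ)
open import Data.List using (allFin)
open import Data.Product using (Σ; _×_; _,_; proj₁; proj₂)
open import Data.Unit using (⊤)
open import Data.Empty using (⊥)
import Data.Vec
open import Data.Sum using (_⊎_)
open import Relation.Binary.PropositionalEquality using (_≡_; _≢_)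
open import Relation.Nullary using (¬_)
open import Relation.Unary using (Pred)
open import Function.Bundles using (_⇔_)

-- Density operators, superoperators and
-- measurements are not available in agda-stdlib; the statement is
-- proved for EVERY model of the following signature (the concrete
-- model of density operators on H_S is one instance).
--   State S     : density operators on H_S (S = list of qubit names of ρ)
--   Sop n       : trace-preserving superoperators of arity n
--   Meas n k    : measurements on n qubits with outcomes 0..k-1
--   applyS E q̃ ρ = E^{q̃}(ρ)
--   applyM M q̃ ρ m = (p_m , M_m^{q̃}(ρ)/p_m)

record QModel : Set₁ where
  field
    Prob   : Set
    one    : Prob
    State  : List ℕ → Set
    Sop    : ℕ → Set
    Meas   : ℕ → ℕ → Set
    applyS : ∀ {S n} → Sop n → Vec ℕ n → State S → State S
    applyM : ∀ {S n k} → Meas n k → Vec ℕ n → State S → Fin k → Prob × State S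

Tag : Set
Tag = ℕ

data Ty : Set where
  N B Qt : Ty

data Classical : Ty → Set where
  cN : Classical N
  cB : Classical B

eqTy : Ty → Ty → Bool
eqTy N N = true
eqTy B B = true
eqTy Qt Qt = true
eqTy _ _ = false

Var : Set
Var = Ty × ℕ

Chan : Set
Chan = Ty × ℕ

varTy : Var → Ty
varTy (T , _) = T

chTy : Chan → Ty
chTy (T , _) = T

eqVar : Var → Var → Bool
eqVar (T , x) (U , y) = eqTy T U ∧ (x ≡ℕ y)

data Exp : Set where
  var  : Var → Exp
  bool : Bool → Exp
  nat  : ℕ → Exp
  qn   : ℕ → Exp
  neg  : Exp → Exp
  _or_ : Exp → Exp → Exp
  _le_ : Exp → Exp → Exp
  _eq_ : Exp → Exp → Exp

data Val : Set where
  vnat  : ℕ → Val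
  vbool : Bool → Val
  vname : ℕ → Val

valExp : Val → Exp
valExp (vnat n) = nat n
valExp (vbool b) = bool b
valExp (vname q) = qn q

eqVal : Val → Val → Maybe Bool
eqVal (vnat m) (vnat n) = just (m ≡ℕ n)
eqVal (vbool true) (vbool b) = just b
eqVal (vbool false) (vbool b) = just (not b)
eqVal (vname p) (vname q) = just (p ≡ℕ q)
eqVal _ _ = nothing

-- evaluation of closed expressions: e ⇓ v  iff  eval e ≡ just v
eval : Exp → Maybe Val
eval (var x) = nothing
eval (bool b) = just (vbool b)
eval (nat n) = just (vnat n)
eval (qn q) = just (vname q)
eval (neg e) with eval e
... | just (vbool b) = just (vbool (not b))
... | _ = nothing
eval (e or e') with eval e | eval e'
... | just (vbool b) | just (vbool b') = just (vbool (b ∨ b'))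
... | _ | _ = nothing
eval (e le e') with eval e | eval e'
... | just (vnat m) | just (vnat n) = just (vbool (m ≤ℕ n))
... | _ | _ = nothing
eval (e eq e') with eval e | eval e'
... | just v | just v' with eqVal v v'
...   | just b = just (vbool b)
...   | nothing = nothing
eval (e eq e') | _ | _ = nothing

data ⊢e_∶_ : Exp → Ty → Set where
  tvar  : ∀ {x} → ⊢e var x ∶ varTy x
  tbool : ∀ {b} → ⊢e bool b ∶ B
  tnat  : ∀ {n} → ⊢e nat n ∶ N
  tqn   : ∀ {q} → ⊢e qn q ∶ Qt
  tneg  : ∀ {e} → ⊢e e ∶ B → ⊢e neg e ∶ B
  tor   : ∀ {e e'} → ⊢e e ∶ B → ⊢e e' ∶ B → ⊢e (e or e') ∶ B
  tle   : ∀ {e e'} → ⊢e e ∶ N → ⊢e e' ∶ N → ⊢e (e le e') ∶ B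
  teq   : ∀ {e e' T} → ⊢e e ∶ T → ⊢e e' ∶ T → ⊢e (e eq e') ∶ B

substE : Var → Val → Exp → Exp
substE x v (var y) = if eqVar x y then valExp v else var y
substE x v (bool b) = bool b
substE x v (nat n) = nat n
substE x v (qn q) = qn q
substE x v (neg e) = neg (substE x v e)
substE x v (e or e') = substE x v e or substE x v e'
substE x v (e le e') = substE x v e le substE x v e'
substE x v (e eq e') = substE x v e eq substE x v e'

fvE : Exp → List Var
fvE (var y) = y ∷ []
fvE (bool b) = []
fvE (nat n) = []
fvE (qn q) = []
fvE (neg e) = fvE e
fvE (e or e') = fvE e ++ fvE e'
fvE (e le e') = fvE e ++ fvE e'
fvE (e eq e') = fvE e ++ fvE e'

-- Quantum typing contexts: sets of qubit names and quantum variables,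
-- represented by lists, always used up to membership (set equality).

data Atom : Set where
  name : ℕ → Atom
  qvar : ℕ → Atom

atom : Exp → Maybe Atom
atom (qn q) = just (name q)
atom (var (Qt , x)) = just (qvar x)
atom _ = nothing

data AtomsOf : List Exp → List Atom → Set where
  []  : AtomsOf [] []
  _∷_ : ∀ {e es a as} → atom e ≡ just a → AtomsOf es as → AtomsOf (e ∷ es) (a ∷ as)

Enumerates : List Exp → List Atom → Set
Enumerates es Γ = Σ (List Atom) λ as → AtomsOf es as × Unique as × (∀ a → (a ∈ as) ⇔ (a ∈ Γ))

EnumSubset : List Exp → List Atom → Set
EnumSubset es Γ = Σ (List Atom) λ as → AtomsOf es as × Unique as × (∀ {a} → a ∈ as → a ∈ Γ)

removeV : Var → List Var → List Var
removeV y [] = []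
removeV y (z ∷ zs) = if eqVar y z then removeV y zs else z ∷ removeV y zs

Disjoint : List Atom → List Atom → Set
Disjoint Γ₁ Γ₂ = ∀ {a} → a ∈ Γ₁ → a ∈ Γ₂ → ⊥

module Lang (QM : QModel) where
  open QModel QM

  infixl 6 _⊕_
  infixl 5 _∥_
  infixl 7 _∖_

  data Proc : Set where
    tau   : Tag → Proc → Proc
    tau2  : Tag → Tag → Proc → Proc
    sop   : Tag → ∀ {n} → Sop n → Vec Exp n → Proc → Proc
    meas  : Tag → ∀ {n k} → Meas n k → Vec Exp n → Var → Proc → Proc
    recv  : Tag → Chan → Var → Proc → Proc
    nil   : List Exp → Proc
    send  : Tag → Chan → Exp → Proc → Proc
    ite   : Exp → Proc → Proc → Proc
    _⊕_   : Proc → Proc → Proc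
    _∥_   : Proc → Proc → Proc
    _∖_   : Proc → Chan → Proc

  subst : Var → Val → Proc → Proc
  subst x v (tau t P) = tau t (subst x v P)
  subst x v (tau2 t t' P) = tau2 t t' (subst x v P)
  subst x v (sop t E es P) = sop t E (Data.Vec.map (substE x v) es) (subst x v P)
  subst x v (meas t M es y P) =
    meas t M (Data.Vec.map (substE x v) es) y (if eqVar x y then P else subst x v P)
  subst x v (recv t c y P) = recv t c y (if eqVar x y then P else subst x v P)
  subst x v (nil es) = nil (map (substE x v) es)
  subst x v (send t c e P) = send t c (substE x v e) (subst x v P)
  subst x v (ite e P Q) = ite (substE x v e) (subst x v P) (subst x v Q)
  subst x v (P ⊕ Q) = subst x v P ⊕ subst x v Q
  subst x v (P ∥ Q) = subst x v P ∥ subst x v Q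
  subst x v (P ∖ c) = subst x v P ∖ c

  fv : Proc → List Var
  fv (tau t P) = fv P
  fv (tau2 t t' P) = fv P
  fv (sop t E es P) = concatMap fvE (toList es) ++ fv P
  fv (meas t M es y P) = concatMap fvE (toList es) ++ removeV y (fv P)
  fv (recv t c y P) = removeV y (fv P)
  fv (nil es) = concatMap fvE es
  fv (send t c e P) = fvE e ++ fv P
  fv (ite e P Q) = fvE e ++ fv P ++ fv Q
  fv (P ⊕ Q) = fv P ++ fv Q
  fv (P ∥ Q) = fv P ++ fv Q
  fv (P ∖ c) = fv P

  Closed : Proc → Set
  Closed P = fv P ≡ []

  infix 3 _⊢_

  data _⊢_ : List Atom → Proc → Set where
    ⊢nil   : ∀ {Γ es} → Enumerates es Γ → Γ ⊢ nil es
    ⊢tau   : ∀ {Γ t P} → Γ ⊢ P → Γ ⊢ tau t P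
    ⊢tau2  : ∀ {Γ t t' P} → Γ ⊢ P → Γ ⊢ tau2 t t' P
    ⊢res   : ∀ {Γ P c} → Γ ⊢ P → Γ ⊢ P ∖ c
    ⊢sum   : ∀ {Γ P Q} → Γ ⊢ P → Γ ⊢ Q → Γ ⊢ P ⊕ Q
    ⊢ite   : ∀ {Γ e P Q} → ⊢e e ∶ B → Γ ⊢ P → Γ ⊢ Q → Γ ⊢ ite e P Q
    ⊢sop   : ∀ {Γ t n P} {E : Sop n} {es : Vec Exp n} →
             EnumSubset (toList es) Γ → Γ ⊢ P → Γ ⊢ sop t E es P
    ⊢meas  : ∀ {Γ t n k P y} {M : Meas n k} {es : Vec Exp n} →
             EnumSubset (toList es) Γ → varTy y ≡ N → Γ ⊢ P → Γ ⊢ meas t M es y P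
    ⊢crecv : ∀ {Γ t c x P} → Classical (chTy c) → varTy x ≡ chTy c →
             Γ ⊢ P → Γ ⊢ recv t c x P
    ⊢qrecv : ∀ {Γ t c x P} → chTy c ≡ Qt → varTy x ≡ Qt → qvar (proj₂ x) ∉ Γ →
             (qvar (proj₂ x) ∷ Γ) ⊢ P → Γ ⊢ recv t c x P
    ⊢csend : ∀ {Γ t c e P} → Classical (chTy c) → ⊢e e ∶ chTy c →
             Γ ⊢ P → Γ ⊢ send t c e P
    ⊢qsend : ∀ {Γ Γ' t c e a P} → chTy c ≡ Qt → atom e ≡ just a → a ∈ Γ →
             (∀ b → (b ∈ Γ') ⇔ (b ∈ Γ × b ≢ a)) →
             Γ' ⊢ P → Γ ⊢ send t c e P
    ⊢par   : ∀ {Γ Γ₁ Γ₂ P Q} → Disjoint Γ₁ Γ₂ →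
             (∀ a → (a ∈ Γ) ⇔ (a ∈ Γ₁ ⊎ a ∈ Γ₂)) →
             Γ₁ ⊢ P → Γ₂ ⊢ Q → Γ ⊢ P ∥ Q

  -- ⟨ρ , P⟩ with ρ a state on the qubits S = Σ_ρ
  Conf : Set
  Conf = Σ (List ℕ) λ S → State S × Proc

  -- finitely supported distributions: weighted lists; support = entries
  Dist : Set
  Dist = List (Prob × Conf)

  point : Conf → Dist
  point c = (one , c) ∷ []

  _∥D_ : Dist → Proc → Dist
  Δ ∥D Q = map (λ { (p , (S , ρ , P)) → (p , (S , ρ , P ∥ Q)) }) Δ

  _∥D'_ : Proc → Dist → Dist
  Q ∥D' Δ = map (λ { (p , (S , ρ , P)) → (p , (S , ρ , Q ∥ P)) }) Δ

  _∖D_ : Dist → Chan → Dist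
  Δ ∖D c = map (λ { (p , (S , ρ , P)) → (p , (S , ρ , P ∖ c)) }) Δ

  data Sched : Set where
    h    : Sched
    tg   : Tag → Sched
    pair : Tag → Tag → Sched

  data Act : Set where
    τ   : Act
    out : Chan → Val → Act
    inp : Chan → Val → Act

  NotOn : Chan → Act → Set
  NotOn c μ = (∀ v → μ ≢ out c v) × (∀ v → μ ≢ inp c v)

  RecvOwned : Act → Proc → Set
  RecvOwned μ Q = Σ Chan λ c → Σ ℕ λ q → μ ≡ inp c (vname q) ×
                  Σ (List Atom) λ ΓQ → (ΓQ ⊢ Q) × (name q ∈ ΓQ)

  Admissible : List ℕ → Ty → Val → Set
  Admissible S N (vnat _) = ⊤
  Admissible S B (vbool _) = ⊤
  Admissible S Qt (vname q) = q ∈ S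
  Admissible S _ _ = ⊥

  NamesOf : ∀ {n} → List ℕ → Vec Exp n → Vec ℕ n → Set
  NamesOf S es qs = es ≡ Data.Vec.map qn qs × Unique (toList qs) × All (_∈ S) (toList qs)

  measDist : ∀ {S n k} → Meas n k → Vec ℕ n → State S → Var → Proc → Dist
  measDist {S} {k = k} M qs ρ y P =
    map (λ m → let r = applyM M qs ρ m in (proj₁ r , (S , proj₂ r , subst y (vnat (toℕ m)) P)))
        (allFin k)

  data Step {S : List ℕ} (ρ : State S) : Proc → Act → Sched → Dist → Set where
    s-tau   : ∀ {t P} → Step ρ (tau t P) τ (tg t) (point (S , ρ , P))
    s-tau2  : ∀ {t t' P} → Step ρ (tau2 t t' P) τ (pair t t') (point (S , ρ , P))
    s-send  : ∀ {t c e v P} → eval e ≡ just v →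
              Step ρ (send t c e P) (out c v) (tg t) (point (S , ρ , P))
    s-recv  : ∀ {t c x v P} → Admissible S (chTy c) v →
              Step ρ (recv t c x P) (inp c v) (tg t) (point (S , ρ , subst x v P))
    s-sop   : ∀ {t n P} {E : Sop n} {es : Vec Exp n} {qs : Vec ℕ n} → NamesOf S es qs →
              Step ρ (sop t E es P) τ (tg t) (point (S , applyS E qs ρ , P))
    s-meas  : ∀ {t n k y P} {M : Meas n k} {es : Vec Exp n} {qs : Vec ℕ n} → NamesOf S es qs →
              Step ρ (meas t M es y P) τ (tg t) (measDist M qs ρ y P)
    s-ifT   : ∀ {e P Q μ s Δ} → eval e ≡ just (vbool true) → Step ρ P μ s Δ →
              Step ρ (ite e P Q) μ s Δ
    s-ifF   : ∀ {e P Q μ s Δ} → eval e ≡ just (vbool false) → Step ρ Q μ s Δ →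
              Step ρ (ite e P Q) μ s Δ
    s-sumL  : ∀ {P Q μ s Δ} → Step ρ P μ s Δ → Step ρ (P ⊕ Q) μ s Δ
    s-sumR  : ∀ {P Q μ s Δ} → Step ρ Q μ s Δ → Step ρ (P ⊕ Q) μ s Δ
    s-res   : ∀ {P c μ s Δ} → NotOn c μ → Step ρ P μ s Δ → Step ρ (P ∖ c) μ s (Δ ∖D c)
    s-parL  : ∀ {P Q μ s Δ} → ¬ RecvOwned μ Q → Step ρ P μ s Δ →
              Step ρ (P ∥ Q) μ s (Δ ∥D Q)
    s-parR  : ∀ {P Q μ s Δ} → ¬ RecvOwned μ P → Step ρ Q μ s Δ →
              Step ρ (P ∥ Q) μ s (P ∥D' Δ)
    s-comL  : ∀ {P P' Q Q' c v t t'} →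
              Step ρ P (out c v) (tg t) (point (S , ρ , P')) →
              Step ρ Q (inp c v) (tg t') (point (S , ρ , Q')) →
              Step ρ (P ∥ Q) τ (pair t t') (point (S , ρ , P' ∥ Q'))
    s-comR  : ∀ {P P' Q Q' c v t t'} →
              Step ρ P (out c v) (tg t) (point (S , ρ , P')) →
              Step ρ Q (inp c v) (tg t') (point (S , ρ , Q')) →
              Step ρ (Q ∥ P) τ (pair t t') (point (S , ρ , Q' ∥ P'))

  _⊆ₙ_ : List Atom → List ℕ → Set
  Γ ⊆ₙ S = ∀ {a} → a ∈ Γ → a ∈ map name S

  ConfTyped : List ℕ → List Atom → Conf → Set
  ConfTyped S Γ (S' , ρ' , P') = S' ≡ S × (Γ ⊢ P') × Γ ⊆ₙ S

  DistTyped : List ℕ → List Atom → Dist → Set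
  DistTyped S Γ Δ = ∀ {p c} → (p , c) ∈ Δ → ConfTyped S Γ c

-- Prefix steps keep the context,
-- and a measurement substitutes a natural number for a classical variable,
-- which preserves typing. The delicate case is communication of a qubit q:
-- the sender's residual is typed in its context without q, the receiver's in
-- its context with the bound variable renamed to q, and the two still
-- partition the original context. The renaming is the transposition of the
-- variable and q; being a bijection on atoms, it transports disjointness,
-- unions and removals of contexts.

module Submission where

open import Defs
open import Data.Bool using (true; false; if_then_else_)
open import Data.Bool.Properties using (T-≡)
open import Data.Maybe using (just)
open import Data.Empty using (⊥-elim)
open import Data.List using (List; []; _∷_; map; _++_)
open import Data.List.Properties using (map-id-local)
open import Data.List.Membership.Propositional using (_∈_; _∉_)
open import Data.List.Membership.Propositional.Properties
  using (∈-map⁺; ∈-map⁻; ∈-++⁺ˡ; ∈-++⁺ʳ; ∈-++⁻)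
open import Data.List.Relation.Binary.BagAndSetEquality using (map-cong)
import Data.List.Relation.Binary.Subset.Propositional.Properties as Subset
import Data.List.Relation.Unary.All as All
open import Data.List.Relation.Unary.Any using (here; there)
import Data.List.Relation.Unary.Unique.Propositional.Properties as Unique
open import Data.Nat using (ℕ) renaming (_≡ᵇ_ to _≡ℕ_)
import Data.Nat.Properties as ℕ
open import Data.Product using (∃; _×_; _,_; proj₁; proj₂)
import Data.Product as Product
open import Data.Sum using (_⊎_; inj₁; inj₂; [_,_]′; swap)
import Data.Sum as Sum
open import Data.Vec using (Vec; toList)
import Data.Vec as Vec
open import Data.Vec.Properties using (toList-map)
open import Function using (_∘_)
open import Function.Bundles using (_⇔_; mk⇔; Equivalence)
open import Function.Definitions using (Injective)
open import Relation.Binary.PropositionalEquality as ≡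
  using (_≡_; _≢_; refl; sym; cong; cong₂)
open import Relation.Nullary using (Dec; yes; no)
open import Relation.Nullary.Decidable using (map′)

open Equivalence using (to; from)

≡ᵇ-refl : ∀ n → (n ≡ℕ n) ≡ true
≡ᵇ-refl n = to T-≡ (ℕ.≡⇒≡ᵇ n n refl)

≡ᵇ-true⇒≡ : ∀ {m n} → (m ≡ℕ n) ≡ true → m ≡ n
≡ᵇ-true⇒≡ {m} {n} m≡n = ℕ.≡ᵇ⇒≡ m n (from T-≡ m≡n)

infix 4 _≟ₐ_

_≟ₐ_ : (a b : Atom) → Dec (a ≡ b)
name m ≟ₐ name n = map′ (cong name) (λ { refl → refl }) (m ℕ.≟ n)
qvar m ≟ₐ qvar n = map′ (cong qvar) (λ { refl → refl }) (m ℕ.≟ n)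
name _ ≟ₐ qvar _ = no λ ()
qvar _ ≟ₐ name _ = no λ ()

infix 4 _≈_∪_ _≈_∖_

_≈_∪_ : List Atom → List Atom → List Atom → Set
Γ ≈ Γ₁ ∪ Γ₂ = ∀ a → a ∈ Γ ⇔ (a ∈ Γ₁ ⊎ a ∈ Γ₂)

_≈_∖_ : List Atom → List Atom → Atom → Set
Γ' ≈ Γ ∖ a = ∀ b → b ∈ Γ' ⇔ (b ∈ Γ × b ≢ a)

∪-comm : ∀ {Γ Γ₁ Γ₂} → Γ ≈ Γ₁ ∪ Γ₂ → Γ ≈ Γ₂ ∪ Γ₁
∪-comm Γ≈ a = mk⇔ (swap ∘ to (Γ≈ a)) (from (Γ≈ a) ∘ swap)

disjoint-sym : ∀ {Γ₁ Γ₂} → Disjoint Γ₁ Γ₂ → Disjoint Γ₂ Γ₁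
disjoint-sym dj a∈₂ a∈₁ = dj a∈₁ a∈₂

disjoint-∷ˡ : ∀ {Γ₁ Γ₂ a} → a ∉ Γ₂ → Disjoint Γ₁ Γ₂ → Disjoint (a ∷ Γ₁) Γ₂
disjoint-∷ˡ a∉₂ dj (here refl) = a∉₂
disjoint-∷ˡ a∉₂ dj (there b∈₁) = dj b∈₁

disjoint-∖-∷ʳ : ∀ {Γ₁ Γ₁' Γ₂ a} → Disjoint Γ₁ Γ₂ → Γ₁' ≈ Γ₁ ∖ a → Disjoint Γ₁' (a ∷ Γ₂)
disjoint-∖-∷ʳ dj Γ₁'≈ b∈₁' (here refl) = proj₂ (to (Γ₁'≈ _) b∈₁') refl
disjoint-∖-∷ʳ dj Γ₁'≈ b∈₁' (there b∈₂) = dj (proj₁ (to (Γ₁'≈ _) b∈₁')) b∈₂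

++-∪ : ∀ Γ₁ Γ₂ → (Γ₁ ++ Γ₂) ≈ Γ₁ ∪ Γ₂
++-∪ Γ₁ _ _ = mk⇔ (∈-++⁻ Γ₁) [ ∈-++⁺ˡ , ∈-++⁺ʳ Γ₁ ]′

∷-∪ˡ : ∀ {Γ Γ₁ Γ₂ a} → Γ ≈ Γ₁ ∪ Γ₂ → (a ∷ Γ) ≈ (a ∷ Γ₁) ∪ Γ₂
∷-∪ˡ Γ≈ b = mk⇔
  (λ { (here b≡a) → inj₁ (here b≡a) ; (there b∈) → Sum.map₁ there (to (Γ≈ b) b∈) })
  (λ { (inj₁ (here b≡a)) → here b≡a
     ; (inj₁ (there b∈₁)) → there (from (Γ≈ b) (inj₁ b∈₁))
     ; (inj₂ b∈₂) → there (from (Γ≈ b) (inj₂ b∈₂)) })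

∖-∪ˡ : ∀ {Γ Γ₁ Γ₁' Γ₂ a} → Disjoint Γ₁ Γ₂ → a ∈ Γ₁ → Γ ≈ Γ₁ ∪ Γ₂ → Γ₁' ≈ Γ₁ ∖ a →
       (Γ₁' ++ Γ₂) ≈ Γ ∖ a
∖-∪ˡ {Γ} {Γ₁' = Γ₁'} {Γ₂} {a} dj a∈₁ Γ≈ Γ₁'≈ b = mk⇔ fwd bwd
  where
  fwd : b ∈ Γ₁' ++ Γ₂ → b ∈ Γ × b ≢ a
  fwd b∈ with ∈-++⁻ Γ₁' b∈
  ... | inj₁ b∈₁' = Product.map₁ (from (Γ≈ b) ∘ inj₁) (to (Γ₁'≈ b) b∈₁')
  ... | inj₂ b∈₂ = from (Γ≈ b) (inj₂ b∈₂) , λ { refl → dj a∈₁ b∈₂ }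
  bwd : b ∈ Γ × b ≢ a → b ∈ Γ₁' ++ Γ₂
  bwd (b∈ , b≢a) with to (Γ≈ b) b∈
  ... | inj₁ b∈₁ = ∈-++⁺ˡ (from (Γ₁'≈ b) (b∈₁ , b≢a))
  ... | inj₂ b∈₂ = ∈-++⁺ʳ Γ₁' b∈₂

∪-move : ∀ {Γ Γ₁ Γ₁' Γ₂ a} → a ∈ Γ₁ → Γ₁' ≈ Γ₁ ∖ a → Γ ≈ Γ₁ ∪ Γ₂ → Γ ≈ Γ₁' ∪ (a ∷ Γ₂)
∪-move {Γ} {Γ₁' = Γ₁'} {Γ₂} {a} a∈₁ Γ₁'≈ Γ≈ b = mk⇔ fwd bwd
  where
  fwd : b ∈ Γ → b ∈ Γ₁' ⊎ b ∈ a ∷ Γ₂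
  fwd b∈ with to (Γ≈ b) b∈ | b ≟ₐ a
  ... | inj₂ b∈₂ | _ = inj₂ (there b∈₂)
  ... | inj₁ _ | yes b≡a = inj₂ (here b≡a)
  ... | inj₁ b∈₁ | no b≢a = inj₁ (from (Γ₁'≈ b) (b∈₁ , b≢a))
  bwd : b ∈ Γ₁' ⊎ b ∈ a ∷ Γ₂ → b ∈ Γ
  bwd (inj₁ b∈₁') = from (Γ≈ b) (inj₁ (proj₁ (to (Γ₁'≈ b) b∈₁')))
  bwd (inj₂ (here refl)) = from (Γ≈ b) (inj₁ a∈₁)
  bwd (inj₂ (there b∈₂)) = from (Γ≈ b) (inj₂ b∈₂)

module _ {f : Atom → Atom} where

  ∈-map-injective : Injective _≡_ _≡_ f → ∀ {a Γ} → f a ∈ map f Γ → a ∈ Γ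
  ∈-map-injective f-inj fa∈ with ∈-map⁻ f fa∈
  ... | b , b∈ , fa≡fb = ≡.subst (_∈ _) (sym (f-inj fa≡fb)) b∈

  map-≈ : ∀ {Γ Γ'} → (∀ a → a ∈ Γ ⇔ a ∈ Γ') → ∀ a → a ∈ map f Γ ⇔ a ∈ map f Γ'
  map-≈ Γ≈Γ' a = map-cong (λ _ → refl) (λ {b} → Γ≈Γ' b) {a}

  map-∪ : ∀ {Γ Γ₁ Γ₂} → Γ ≈ Γ₁ ∪ Γ₂ → map f Γ ≈ map f Γ₁ ∪ map f Γ₂
  map-∪ {Γ} {Γ₁} {Γ₂} Γ≈ b = mk⇔ fwd bwd
    where
    fwd : b ∈ map f Γ → b ∈ map f Γ₁ ⊎ b ∈ map f Γ₂
    fwd b∈ with ∈-map⁻ f b∈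
    ... | c , c∈ , refl = Sum.map (∈-map⁺ f) (∈-map⁺ f) (to (Γ≈ c) c∈)
    bwd : b ∈ map f Γ₁ ⊎ b ∈ map f Γ₂ → b ∈ map f Γ
    bwd (inj₁ b∈₁) with ∈-map⁻ f b∈₁
    ... | c , c∈₁ , refl = ∈-map⁺ f (from (Γ≈ c) (inj₁ c∈₁))
    bwd (inj₂ b∈₂) with ∈-map⁻ f b∈₂
    ... | c , c∈₂ , refl = ∈-map⁺ f (from (Γ≈ c) (inj₂ c∈₂))

  map-∖ : Injective _≡_ _≡_ f → ∀ {Γ Γ' a} → Γ' ≈ Γ ∖ a → map f Γ' ≈ map f Γ ∖ f a
  map-∖ f-inj {Γ} {Γ'} {a} Γ'≈ b = mk⇔ fwd bwd
    where
    fwd : b ∈ map f Γ' → b ∈ map f Γ × b ≢ f a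
    fwd b∈ with ∈-map⁻ f b∈
    ... | c , c∈ , refl with to (Γ'≈ c) c∈
    ...   | c∈Γ , c≢a = ∈-map⁺ f c∈Γ , c≢a ∘ f-inj
    bwd : b ∈ map f Γ × b ≢ f a → b ∈ map f Γ'
    bwd (b∈ , b≢fa) with ∈-map⁻ f b∈
    ... | c , c∈ , refl = ∈-map⁺ f (from (Γ'≈ c) (c∈ , b≢fa ∘ cong f))

  map-disjoint : Injective _≡_ _≡_ f → ∀ {Γ₁ Γ₂} → Disjoint Γ₁ Γ₂ → Disjoint (map f Γ₁) (map f Γ₂)
  map-disjoint f-inj dj b∈₁ b∈₂ with ∈-map⁻ f b∈₁
  ... | c , c∈₁ , refl = dj c∈₁ (∈-map-injective f-inj b∈₂)

transpose : ℕ → ℕ → Atom → Atom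
transpose x q (name n) = if n ≡ℕ q then qvar x else name n
transpose x q (qvar z) = if x ≡ℕ z then name q else qvar z

transpose-qvar : ∀ x q → transpose x q (qvar x) ≡ name q
transpose-qvar x q rewrite ≡ᵇ-refl x = refl

transpose-involutive : ∀ x q a → transpose x q (transpose x q a) ≡ a
transpose-involutive x q (name n) with n ≡ℕ q in n≡q
... | true rewrite ≡ᵇ-refl x = cong name (sym (≡ᵇ-true⇒≡ n≡q))
... | false rewrite n≡q = refl
transpose-involutive x q (qvar z) with x ≡ℕ z in x≡z
... | true rewrite ≡ᵇ-refl q = cong qvar (≡ᵇ-true⇒≡ x≡z)
... | false rewrite x≡z = refl

transpose-injective : ∀ x q → Injective _≡_ _≡_ (transpose x q)
transpose-injective x q {a} {b} ta≡tb = begin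
  a                                   ≡⟨ sym (transpose-involutive x q a) ⟩
  transpose x q (transpose x q a)     ≡⟨ cong (transpose x q) ta≡tb ⟩
  transpose x q (transpose x q b)     ≡⟨ transpose-involutive x q b ⟩
  b                                   ∎
  where open ≡.≡-Reasoning

transpose-fixes : ∀ {x q a} → a ≢ qvar x → a ≢ name q → transpose x q a ≡ a
transpose-fixes {x} {q} {name n} _ a≢q with n ≡ℕ q in n≡q
... | true = ⊥-elim (a≢q (cong name (≡ᵇ-true⇒≡ n≡q)))
... | false = refl
transpose-fixes {x} {q} {qvar z} a≢x _ with x ≡ℕ z in x≡z
... | true = ⊥-elim (a≢x (cong qvar (sym (≡ᵇ-true⇒≡ x≡z))))
... | false = refl

map-transpose-fresh : ∀ {x q Γ} → qvar x ∉ Γ → name q ∉ Γ → map (transpose x q) Γ ≡ Γ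
map-transpose-fresh x∉ q∉ =
  map-id-local (All.tabulate λ a∈ → transpose-fixes (λ { refl → x∉ a∈ }) (λ { refl → q∉ a∈ }))

classical-≢-Qt : ∀ {T} → Classical T → T ≢ Qt
classical-≢-Qt cN ()
classical-≢-Qt cB ()

atom-eval : ∀ {e a v} → atom e ≡ just a → eval e ≡ just v → ∃ λ q → a ≡ name q × v ≡ vname q
atom-eval {qn q} refl refl = q , refl , refl
atom-eval {var _} _ ()
atom-eval {bool _} () _
atom-eval {nat _} () _
atom-eval {neg _} () _
atom-eval {_ or _} () _
atom-eval {_ le _} () _
atom-eval {_ eq _} () _

eqVar⇒≡varTy : ∀ x y → eqVar x y ≡ true → varTy x ≡ varTy y
eqVar⇒≡varTy (N , _) (N , _) _ = refl
eqVar⇒≡varTy (B , _) (B , _) _ = refl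
eqVar⇒≡varTy (Qt , _) (Qt , _) _ = refl
eqVar⇒≡varTy (N , _) (B , _) ()
eqVar⇒≡varTy (N , _) (Qt , _) ()
eqVar⇒≡varTy (B , _) (N , _) ()
eqVar⇒≡varTy (B , _) (Qt , _) ()
eqVar⇒≡varTy (Qt , _) (N , _) ()
eqVar⇒≡varTy (Qt , _) (B , _) ()

⊢e-substE : ∀ {x v e T} → ⊢e valExp v ∶ varTy x → ⊢e e ∶ T → ⊢e substE x v e ∶ T
⊢e-substE {x} {v} {var y} ⊢v tvar with eqVar x y in x≡y
... | true = ≡.subst (⊢e valExp v ∶_) (eqVar⇒≡varTy x y x≡y) ⊢v
... | false = tvar
⊢e-substE ⊢v tbool = tbool
⊢e-substE ⊢v tnat = tnat
⊢e-substE ⊢v tqn = tqn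
⊢e-substE ⊢v (tneg ⊢e) = tneg (⊢e-substE ⊢v ⊢e)
⊢e-substE ⊢v (tor ⊢e ⊢e') = tor (⊢e-substE ⊢v ⊢e) (⊢e-substE ⊢v ⊢e')
⊢e-substE ⊢v (tle ⊢e ⊢e') = tle (⊢e-substE ⊢v ⊢e) (⊢e-substE ⊢v ⊢e')
⊢e-substE ⊢v (teq ⊢e ⊢e') = teq (⊢e-substE ⊢v ⊢e) (⊢e-substE ⊢v ⊢e')

atom-substE-classical : ∀ {T n v e a} → Classical T → atom e ≡ just a →
                        atom (substE (T , n) v e) ≡ just a
atom-substE-classical {e = qn _} _ refl = refl
atom-substE-classical {e = var (Qt , _)} cN refl = refl
atom-substE-classical {e = var (Qt , _)} cB refl = refl
atom-substE-classical {e = var (N , _)} _ ()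
atom-substE-classical {e = var (B , _)} _ ()
atom-substE-classical {e = bool _} _ ()
atom-substE-classical {e = nat _} _ ()
atom-substE-classical {e = neg _} _ ()
atom-substE-classical {e = _ or _} _ ()
atom-substE-classical {e = _ le _} _ ()
atom-substE-classical {e = _ eq _} _ ()

atomsOf-substE-classical : ∀ {T n v es as} → Classical T → AtomsOf es as →
                           AtomsOf (map (substE (T , n) v) es) as
atomsOf-substE-classical cl [] = []
atomsOf-substE-classical cl (e↦a ∷ es↦as) =
  atom-substE-classical cl e↦a ∷ atomsOf-substE-classical cl es↦as

-- On name q the transposition would give qvar x, but substitution leaves qn q alone.
atom-substE-qubit : ∀ {x q e a} → atom e ≡ just a → a ≢ name q →
                    atom (substE (Qt , x) (vname q) e) ≡ just (transpose x q a)
atom-substE-qubit {q = q} {e = qn n} refl n≢q with n ≡ℕ q in n≡q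
... | true = ⊥-elim (n≢q (cong name (≡ᵇ-true⇒≡ n≡q)))
... | false = refl
atom-substE-qubit {x} {e = var (Qt , z)} refl _ with x ≡ℕ z
... | true = refl
... | false = refl
atom-substE-qubit {e = var (N , _)} () _
atom-substE-qubit {e = var (B , _)} () _
atom-substE-qubit {e = bool _} () _
atom-substE-qubit {e = nat _} () _
atom-substE-qubit {e = neg _} () _
atom-substE-qubit {e = _ or _} () _
atom-substE-qubit {e = _ le _} () _
atom-substE-qubit {e = _ eq _} () _

atomsOf-substE-qubit : ∀ {x q es as} → name q ∉ as → AtomsOf es as →
                       AtomsOf (map (substE (Qt , x) (vname q)) es) (map (transpose x q) as)
atomsOf-substE-qubit q∉ [] = []
atomsOf-substE-qubit q∉ (e↦a ∷ es↦as) =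
  atom-substE-qubit e↦a (λ { refl → q∉ (here refl) }) ∷ atomsOf-substE-qubit (q∉ ∘ there) es↦as

module SubjectReduction (QM : QModel) where
  open Lang QM

  ⊢-if : ∀ {Γ P Q} b → Γ ⊢ P → Γ ⊢ Q → Γ ⊢ (if b then P else Q)
  ⊢-if true ⊢P _ = ⊢P
  ⊢-if false _ ⊢Q = ⊢Q

  ⊢∥-comm : ∀ {Γ P Q} → Γ ⊢ P ∥ Q → Γ ⊢ Q ∥ P
  ⊢∥-comm (⊢par dj Γ≈ ⊢P ⊢Q) = ⊢par (disjoint-sym dj) (∪-comm Γ≈) ⊢Q ⊢P

  enumSubset-subst-classical : ∀ {T n v Γ k} {es : Vec Exp k} → Classical T →
    EnumSubset (toList es) Γ → EnumSubset (toList (Vec.map (substE (T , n) v) es)) Γ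
  enumSubset-subst-classical {T} {n} {v} {es = es} cl (as , es↦as , unique , as⊆Γ) =
    as , ≡.subst (λ es' → AtomsOf es' as) (sym (toList-map (substE (T , n) v) es))
                 (atomsOf-substE-classical cl es↦as) ,
    unique , as⊆Γ

  ⊢-subst-classical : ∀ {Γ P x v} → Classical (varTy x) → ⊢e valExp v ∶ varTy x →
                      Γ ⊢ P → Γ ⊢ subst x v P
  ⊢-subst-classical cl ⊢v (⊢nil (as , es↦as , unique , as≈Γ)) =
    ⊢nil (as , atomsOf-substE-classical cl es↦as , unique , as≈Γ)
  ⊢-subst-classical cl ⊢v (⊢tau ⊢P) = ⊢tau (⊢-subst-classical cl ⊢v ⊢P)
  ⊢-subst-classical cl ⊢v (⊢tau2 ⊢P) = ⊢tau2 (⊢-subst-classical cl ⊢v ⊢P)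
  ⊢-subst-classical cl ⊢v (⊢res ⊢P) = ⊢res (⊢-subst-classical cl ⊢v ⊢P)
  ⊢-subst-classical cl ⊢v (⊢sum ⊢P ⊢Q) =
    ⊢sum (⊢-subst-classical cl ⊢v ⊢P) (⊢-subst-classical cl ⊢v ⊢Q)
  ⊢-subst-classical cl ⊢v (⊢ite ⊢e ⊢P ⊢Q) =
    ⊢ite (⊢e-substE ⊢v ⊢e) (⊢-subst-classical cl ⊢v ⊢P) (⊢-subst-classical cl ⊢v ⊢Q)
  ⊢-subst-classical cl ⊢v (⊢sop en ⊢P) =
    ⊢sop (enumSubset-subst-classical cl en) (⊢-subst-classical cl ⊢v ⊢P)
  ⊢-subst-classical {x = x} cl ⊢v (⊢meas {y = y} en y:N ⊢P) =
    ⊢meas (enumSubset-subst-classical cl en) y:N (⊢-if (eqVar x y) ⊢P (⊢-subst-classical cl ⊢v ⊢P))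
  ⊢-subst-classical {x = x} cl ⊢v (⊢crecv {x = y} cl' y:c ⊢P) =
    ⊢crecv cl' y:c (⊢-if (eqVar x y) ⊢P (⊢-subst-classical cl ⊢v ⊢P))
  ⊢-subst-classical {x = x} cl ⊢v (⊢qrecv {x = y} c:Qt y:Qt y∉ ⊢P) =
    ⊢qrecv c:Qt y:Qt y∉ (⊢-if (eqVar x y) ⊢P (⊢-subst-classical cl ⊢v ⊢P))
  ⊢-subst-classical cl ⊢v (⊢csend cl' ⊢e ⊢P) =
    ⊢csend cl' (⊢e-substE ⊢v ⊢e) (⊢-subst-classical cl ⊢v ⊢P)
  ⊢-subst-classical cl ⊢v (⊢qsend c:Qt e↦a a∈ Γ'≈ ⊢P) =
    ⊢qsend c:Qt (atom-substE-classical cl e↦a) a∈ Γ'≈ (⊢-subst-classical cl ⊢v ⊢P)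
  ⊢-subst-classical cl ⊢v (⊢par dj Γ≈ ⊢P ⊢Q) =
    ⊢par dj Γ≈ (⊢-subst-classical cl ⊢v ⊢P) (⊢-subst-classical cl ⊢v ⊢Q)

  module _ {x q : ℕ} where
    private
      π : Atom → Atom
      π = transpose x q

      π-injective : Injective _≡_ _≡_ π
      π-injective = transpose-injective x q

    enumSubset-subst-qubit : ∀ {Γ k} {es : Vec Exp k} → name q ∉ Γ → EnumSubset (toList es) Γ →
      EnumSubset (toList (Vec.map (substE (Qt , x) (vname q)) es)) (map π Γ)
    enumSubset-subst-qubit {es = es} q∉ (as , es↦as , unique , as⊆Γ) =
      map π as ,
      ≡.subst (λ es' → AtomsOf es' (map π as)) (sym (toList-map (substE (Qt , x) (vname q)) es))
              (atomsOf-substE-qubit (q∉ ∘ as⊆Γ) es↦as) ,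
      Unique.map⁺ π-injective unique ,
      Subset.map⁺ π as⊆Γ

    ⊢-subst-qubit : ∀ {Γ P} → name q ∉ Γ → Γ ⊢ P → map π Γ ⊢ subst (Qt , x) (vname q) P
    ⊢-subst-qubit q∉ (⊢nil (as , es↦as , unique , as≈Γ)) =
      ⊢nil (map π as , atomsOf-substE-qubit (q∉ ∘ to (as≈Γ _)) es↦as ,
            Unique.map⁺ π-injective unique , map-≈ as≈Γ)
    ⊢-subst-qubit q∉ (⊢tau ⊢P) = ⊢tau (⊢-subst-qubit q∉ ⊢P)
    ⊢-subst-qubit q∉ (⊢tau2 ⊢P) = ⊢tau2 (⊢-subst-qubit q∉ ⊢P)
    ⊢-subst-qubit q∉ (⊢res ⊢P) = ⊢res (⊢-subst-qubit q∉ ⊢P)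
    ⊢-subst-qubit q∉ (⊢sum ⊢P ⊢Q) = ⊢sum (⊢-subst-qubit q∉ ⊢P) (⊢-subst-qubit q∉ ⊢Q)
    ⊢-subst-qubit q∉ (⊢ite ⊢e ⊢P ⊢Q) =
      ⊢ite (⊢e-substE tqn ⊢e) (⊢-subst-qubit q∉ ⊢P) (⊢-subst-qubit q∉ ⊢Q)
    ⊢-subst-qubit q∉ (⊢sop en ⊢P) = ⊢sop (enumSubset-subst-qubit q∉ en) (⊢-subst-qubit q∉ ⊢P)
    ⊢-subst-qubit q∉ (⊢meas {y = _ , _} en refl ⊢P) =
      ⊢meas (enumSubset-subst-qubit q∉ en) refl (⊢-subst-qubit q∉ ⊢P)
    ⊢-subst-qubit q∉ (⊢crecv {c = _ , _} {x = _ , _} cN refl ⊢P) = ⊢crecv cN refl (⊢-subst-qubit q∉ ⊢P)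
    ⊢-subst-qubit q∉ (⊢crecv {c = _ , _} {x = _ , _} cB refl ⊢P) = ⊢crecv cB refl (⊢-subst-qubit q∉ ⊢P)
    ⊢-subst-qubit {Γ} q∉ (⊢qrecv {x = _ , z} c:Qt refl z∉ ⊢P) with x ≡ℕ z in x≡z
    ... | true = ≡.subst (_⊢ _) (sym (map-transpose-fresh x∉ q∉)) (⊢qrecv c:Qt refl z∉ ⊢P)
      where
      x∉ : qvar x ∉ Γ
      x∉ = ≡.subst (λ w → qvar w ∉ Γ) (sym (≡ᵇ-true⇒≡ x≡z)) z∉
    ... | false = ⊢qrecv c:Qt refl (z∉ ∘ ∈-map-injective π-injective ∘ ≡.subst (_∈ map π Γ) (sym πz≡z))
                    (≡.subst (λ a → a ∷ map π Γ ⊢ _) πz≡z (⊢-subst-qubit (λ { (here ()) ; (there q∈) → q∉ q∈ }) ⊢P))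
      where
      πz≡z : π (qvar z) ≡ qvar z
      πz≡z rewrite x≡z = refl
    ⊢-subst-qubit q∉ (⊢csend cl ⊢e ⊢P) = ⊢csend cl (⊢e-substE tqn ⊢e) (⊢-subst-qubit q∉ ⊢P)
    ⊢-subst-qubit q∉ (⊢qsend c:Qt e↦a a∈ Γ'≈ ⊢P) =
      ⊢qsend c:Qt (atom-substE-qubit e↦a λ { refl → q∉ a∈ }) (∈-map⁺ π a∈) (map-∖ π-injective Γ'≈)
        (⊢-subst-qubit (q∉ ∘ proj₁ ∘ to (Γ'≈ _)) ⊢P)
    ⊢-subst-qubit q∉ (⊢par dj Γ≈ ⊢P ⊢Q) =
      ⊢par (map-disjoint π-injective dj) (map-∪ Γ≈)
        (⊢-subst-qubit (q∉ ∘ from (Γ≈ _) ∘ inj₁) ⊢P) (⊢-subst-qubit (q∉ ∘ from (Γ≈ _) ∘ inj₂) ⊢Q)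

  data OutputResidual (Γ : List Atom) (c : Chan) : Val → Proc → Set where
    out-classical : ∀ {v P} → Classical (chTy c) → Γ ⊢ P → OutputResidual Γ c v P
    out-qubit : ∀ {q Γ' P} → chTy c ≡ Qt → name q ∈ Γ → Γ' ≈ Γ ∖ name q → Γ' ⊢ P →
                OutputResidual Γ c (vname q) P

  -- The receiver cannot know that q is fresh for it; in a communication this
  -- follows from q being owned by the sender, whose context is disjoint.
  data InputResidual (Γ : List Atom) (c : Chan) : Val → Proc → Set where
    in-classical : ∀ {v P} → Classical (chTy c) → Γ ⊢ P → InputResidual Γ c v P
    in-qubit : ∀ {q P} → chTy c ≡ Qt → (name q ∉ Γ → name q ∷ Γ ⊢ P) →
               InputResidual Γ c (vname q) P

  out-map : ∀ {Γ c v P Q} → (∀ {Γ'} → Γ' ⊢ P → Γ' ⊢ Q) →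
            OutputResidual Γ c v P → OutputResidual Γ c v Q
  out-map f (out-classical cl ⊢P) = out-classical cl (f ⊢P)
  out-map f (out-qubit c:Qt q∈ Γ'≈ ⊢P) = out-qubit c:Qt q∈ Γ'≈ (f ⊢P)

  in-map : ∀ {Γ c v P Q} → (∀ {Γ'} → Γ' ⊢ P → Γ' ⊢ Q) →
           InputResidual Γ c v P → InputResidual Γ c v Q
  in-map f (in-classical cl ⊢P) = in-classical cl (f ⊢P)
  in-map f (in-qubit c:Qt ⊢P) = in-qubit c:Qt (f ∘ ⊢P)

  out-∥ˡ : ∀ {Γ Γ₁ Γ₂ c v P Q} → Disjoint Γ₁ Γ₂ → Γ ≈ Γ₁ ∪ Γ₂ → Γ₂ ⊢ Q →
           OutputResidual Γ₁ c v P → OutputResidual Γ c v (P ∥ Q)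
  out-∥ˡ dj Γ≈ ⊢Q (out-classical cl ⊢P) = out-classical cl (⊢par dj Γ≈ ⊢P ⊢Q)
  out-∥ˡ {Γ₂ = Γ₂} dj Γ≈ ⊢Q (out-qubit {Γ' = Γ₁'} c:Qt q∈₁ Γ₁'≈ ⊢P) =
    out-qubit c:Qt (from (Γ≈ _) (inj₁ q∈₁)) (∖-∪ˡ dj q∈₁ Γ≈ Γ₁'≈)
      (⊢par (dj ∘ proj₁ ∘ to (Γ₁'≈ _)) (++-∪ Γ₁' Γ₂) ⊢P ⊢Q)

  out-∥ʳ : ∀ {Γ Γ₁ Γ₂ c v P Q} → Disjoint Γ₁ Γ₂ → Γ ≈ Γ₁ ∪ Γ₂ → Γ₁ ⊢ P →
           OutputResidual Γ₂ c v Q → OutputResidual Γ c v (P ∥ Q)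
  out-∥ʳ dj Γ≈ ⊢P r = out-map ⊢∥-comm (out-∥ˡ (disjoint-sym dj) (∪-comm Γ≈) ⊢P r)

  in-∥ˡ : ∀ {Γ Γ₁ Γ₂ c v P Q} → Disjoint Γ₁ Γ₂ → Γ ≈ Γ₁ ∪ Γ₂ → Γ₂ ⊢ Q →
          InputResidual Γ₁ c v P → InputResidual Γ c v (P ∥ Q)
  in-∥ˡ dj Γ≈ ⊢Q (in-classical cl ⊢P) = in-classical cl (⊢par dj Γ≈ ⊢P ⊢Q)
  in-∥ˡ dj Γ≈ ⊢Q (in-qubit c:Qt ⊢P) = in-qubit c:Qt λ q∉ →
    ⊢par (disjoint-∷ˡ (q∉ ∘ from (Γ≈ _) ∘ inj₂) dj) (∷-∪ˡ Γ≈) (⊢P (q∉ ∘ from (Γ≈ _) ∘ inj₁)) ⊢Q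

  in-∥ʳ : ∀ {Γ Γ₁ Γ₂ c v P Q} → Disjoint Γ₁ Γ₂ → Γ ≈ Γ₁ ∪ Γ₂ → Γ₁ ⊢ P →
          InputResidual Γ₂ c v Q → InputResidual Γ c v (P ∥ Q)
  in-∥ʳ dj Γ≈ ⊢P r = in-map ⊢∥-comm (in-∥ˡ (disjoint-sym dj) (∪-comm Γ≈) ⊢P r)

  communicate : ∀ {Γ Γ₁ Γ₂ c v P Q} → Disjoint Γ₁ Γ₂ → Γ ≈ Γ₁ ∪ Γ₂ →
                OutputResidual Γ₁ c v P → InputResidual Γ₂ c v Q → Γ ⊢ P ∥ Q
  communicate dj Γ≈ (out-classical _ ⊢P) (in-classical _ ⊢Q) = ⊢par dj Γ≈ ⊢P ⊢Q
  communicate dj Γ≈ (out-qubit _ q∈₁ Γ₁'≈ ⊢P) (in-qubit _ ⊢Q) =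
    ⊢par (disjoint-∖-∷ʳ dj Γ₁'≈) (∪-move q∈₁ Γ₁'≈ Γ≈) ⊢P (⊢Q (dj q∈₁))
  communicate _ _ (out-classical cl _) (in-qubit c:Qt _) = ⊥-elim (classical-≢-Qt cl c:Qt)
  communicate _ _ (out-qubit c:Qt _ _ _) (in-classical cl _) = ⊥-elim (classical-≢-Qt cl c:Qt)

  open QModel QM using (State)

  admissible-classical : ∀ {S T v} → Classical T → Admissible S T v → ⊢e valExp v ∶ T
  admissible-classical {v = vnat _} cN _ = tnat
  admissible-classical {v = vbool _} cB _ = tbool

  admissible-qubit : ∀ {S v} → Admissible S Qt v → ∃ λ q → v ≡ vname q
  admissible-qubit {v = vname q} _ = q , refl

  output-residual : ∀ {S} {ρ : State S} {Γ P c v s Δ p S'} {ρ' : State S'} {P'} →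
                    Γ ⊢ P → Step ρ P (out c v) s Δ → (p , S' , ρ' , P') ∈ Δ →
                    OutputResidual Γ c v P'
  output-residual (⊢csend cl _ ⊢P) (s-send _) (here refl) = out-classical cl ⊢P
  output-residual (⊢qsend c:Qt e↦a a∈ Γ'≈ ⊢P) (s-send e⇓v) (here refl) with atom-eval e↦a e⇓v
  ... | _ , refl , refl = out-qubit c:Qt a∈ Γ'≈ ⊢P
  output-residual _ (s-send _) (there ())
  output-residual (⊢ite _ ⊢P _) (s-ifT _ step) m = output-residual ⊢P step m
  output-residual (⊢ite _ _ ⊢Q) (s-ifF _ step) m = output-residual ⊢Q step m
  output-residual (⊢sum ⊢P _) (s-sumL step) m = output-residual ⊢P step m
  output-residual (⊢sum _ ⊢Q) (s-sumR step) m = output-residual ⊢Q step m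
  output-residual (⊢res ⊢P) (s-res _ step) m with ∈-map⁻ _ m
  ... | _ , m' , refl = out-map ⊢res (output-residual ⊢P step m')
  output-residual (⊢par dj Γ≈ ⊢P ⊢Q) (s-parL _ step) m with ∈-map⁻ _ m
  ... | _ , m' , refl = out-∥ˡ dj Γ≈ ⊢Q (output-residual ⊢P step m')
  output-residual (⊢par dj Γ≈ ⊢P ⊢Q) (s-parR _ step) m with ∈-map⁻ _ m
  ... | _ , m' , refl = out-∥ʳ dj Γ≈ ⊢P (output-residual ⊢Q step m')

  input-residual : ∀ {S} {ρ : State S} {Γ P c v s Δ p S'} {ρ' : State S'} {P'} →
                   Γ ⊢ P → Step ρ P (inp c v) s Δ → (p , S' , ρ' , P') ∈ Δ →
                   InputResidual Γ c v P'
  input-residual (⊢crecv {c = _ , _} {x = _ , _} cl refl ⊢P) (s-recv adm) (here refl) =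
    in-classical cl (⊢-subst-classical cl (admissible-classical cl adm) ⊢P)
  input-residual (⊢qrecv {x = _ , z} {P = P} c:Qt refl z∉ ⊢P) (s-recv adm) (here refl)
    with admissible-qubit (≡.subst (λ T → Admissible _ T _) c:Qt adm)
  ... | q , refl = in-qubit c:Qt λ q∉ →
    ≡.subst (_⊢ subst (Qt , z) (vname q) P) (cong₂ _∷_ (transpose-qvar z q) (map-transpose-fresh z∉ q∉))
      (⊢-subst-qubit (λ { (here ()) ; (there q∈) → q∉ q∈ }) ⊢P)
  input-residual _ (s-recv _) (there ())
  input-residual (⊢ite _ ⊢P _) (s-ifT _ step) m = input-residual ⊢P step m
  input-residual (⊢ite _ _ ⊢Q) (s-ifF _ step) m = input-residual ⊢Q step m
  input-residual (⊢sum ⊢P _) (s-sumL step) m = input-residual ⊢P step m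
  input-residual (⊢sum _ ⊢Q) (s-sumR step) m = input-residual ⊢Q step m
  input-residual (⊢res ⊢P) (s-res _ step) m with ∈-map⁻ _ m
  ... | _ , m' , refl = in-map ⊢res (input-residual ⊢P step m')
  input-residual (⊢par dj Γ≈ ⊢P ⊢Q) (s-parL _ step) m with ∈-map⁻ _ m
  ... | _ , m' , refl = in-∥ˡ dj Γ≈ ⊢Q (input-residual ⊢P step m')
  input-residual (⊢par dj Γ≈ ⊢P ⊢Q) (s-parR _ step) m with ∈-map⁻ _ m
  ... | _ , m' , refl = in-∥ʳ dj Γ≈ ⊢P (input-residual ⊢Q step m')

  τ-subject-reduction : ∀ {S} {ρ : State S} {Γ P s Δ p S'} {ρ' : State S'} {P'} →
                        Γ ⊢ P → Step ρ P τ s Δ → (p , S' , ρ' , P') ∈ Δ → S' ≡ S × Γ ⊢ P'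
  τ-subject-reduction (⊢tau ⊢P) s-tau (here refl) = refl , ⊢P
  τ-subject-reduction (⊢tau2 ⊢P) s-tau2 (here refl) = refl , ⊢P
  τ-subject-reduction (⊢sop _ ⊢P) (s-sop _) (here refl) = refl , ⊢P
  τ-subject-reduction (⊢meas {y = _ , _} _ refl ⊢P) (s-meas _) m with ∈-map⁻ _ m
  ... | _ , _ , refl = refl , ⊢-subst-classical cN tnat ⊢P
  τ-subject-reduction (⊢ite _ ⊢P _) (s-ifT _ step) m = τ-subject-reduction ⊢P step m
  τ-subject-reduction (⊢ite _ _ ⊢Q) (s-ifF _ step) m = τ-subject-reduction ⊢Q step m
  τ-subject-reduction (⊢sum ⊢P _) (s-sumL step) m = τ-subject-reduction ⊢P step m
  τ-subject-reduction (⊢sum _ ⊢Q) (s-sumR step) m = τ-subject-reduction ⊢Q step m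
  τ-subject-reduction (⊢res ⊢P) (s-res _ step) m with ∈-map⁻ _ m
  ... | _ , m' , refl = Product.map₂ ⊢res (τ-subject-reduction ⊢P step m')
  τ-subject-reduction (⊢par dj Γ≈ ⊢P ⊢Q) (s-parL _ step) m with ∈-map⁻ _ m
  ... | _ , m' , refl = Product.map₂ (λ ⊢P' → ⊢par dj Γ≈ ⊢P' ⊢Q) (τ-subject-reduction ⊢P step m')
  τ-subject-reduction (⊢par dj Γ≈ ⊢P ⊢Q) (s-parR _ step) m with ∈-map⁻ _ m
  ... | _ , m' , refl = Product.map₂ (⊢par dj Γ≈ ⊢P) (τ-subject-reduction ⊢Q step m')
  τ-subject-reduction (⊢par dj Γ≈ ⊢P ⊢Q) (s-comL sending receiving) (here refl) =
    refl , communicate dj Γ≈ (output-residual ⊢P sending (here refl)) (input-residual ⊢Q receiving (here refl))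
  τ-subject-reduction (⊢par dj Γ≈ ⊢Q ⊢P) (s-comR sending receiving) (here refl) =
    refl , ⊢∥-comm (communicate (disjoint-sym dj) (∪-comm Γ≈)
                      (output-residual ⊢P sending (here refl)) (input-residual ⊢Q receiving (here refl)))
  τ-subject-reduction _ s-tau (there ())
  τ-subject-reduction _ s-tau2 (there ())
  τ-subject-reduction _ (s-sop _) (there ())
  τ-subject-reduction _ (s-comL _ _) (there ())
  τ-subject-reduction _ (s-comR _ _) (there ())

open QModel using (State)
open Lang

theorem1 : (QM : QModel) {S : List ℕ} (ρ : State QM S) (Γ : List Atom)
    (P : Proc QM) (s : Sched QM) (Δ : Dist QM) →
    Closed QM P → _⊢_ QM Γ P → _⊆ₙ_ QM Γ S →
    Step QM ρ P (τ {QM}) s Δ →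
    DistTyped QM S Γ Δ
theorem1 QM ρ Γ P s Δ _ ⊢P Γ⊆S step m =
  let S'≡S , ⊢P' = SubjectReduction.τ-subject-reduction QM ⊢P step m in S'≡S , ⊢P' , Γ⊆S
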